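{- Let $S$ be a string of length $n$ in which every character occurs at least twice, let $\sigma$ be a character of $S$ occurring $\ell\ge 2$ times, at positions $i_1<\dots<i_\ell$, and let $e=\lfloor \ell/2\rfloor$. Let $Y$ be any maximal common subsequence of $S[i_1,i_{e+1})$ and $S[i_{e+1},n]$ containing $\sigma^e$; if $\ell$ is odd and $Y$ is a subsequence of $S[i_{e+2},n]$, replace $Y$ by any maximal common subsequence of $S[i_1,i_{e+2})$ and $S[i_{e+2},n]$ containing the old $Y$. Then $X_1=YY$ is not inner-extendable.
   Context: For a string $S$, $S[i,j]=S[i]\cdots S[j]$ (empty if $j<i$), $S[i,j)=S[i,j-1]$, $S(i,j]=S[i+1,j]$; $\sigma^e$ is $e$ copies of $\sigma$. A common subsequence $C$ of $S_1,S_2$ is maximal if no common subsequence of $S_1,S_2$ properly contains it. A square subsequence $WW$ of $S$ is inner-extendable if there is a character $y$ and a factorization $W=W_1W_2$ with $W_1,W_2$ both nonempty such that $W_1yW_2W_1yW_2$ is a subsequence of $S$. -}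

module Defs where

open import Data.Nat using (ℕ; zero; suc; _∸_)
open import Data.List using (List; []; _∷_; _++_; take; drop; length; replicate)
open import Data.Product using (Σ; ∃; _×_; _,_)
open import Relation.Nullary using (¬_; yes; no)
open import Relation.Binary.Definitions using (DecidableEquality)
open import Relation.Binary.PropositionalEquality using (_≡_; _≢_)
open import Data.List.Relation.Binary.Sublist.Propositional using (_⊆_)

-- Strings over an alphabet A are lists; positions are 1-based, as in the paper.

-- Factors (1-based): S[i,j) = S[i] ⋯ S[j-1],  S[i,n] = suffix starting at position i.
factorCO : {A : Set} → List A → ℕ → ℕ → List A
factorCO S i j = drop (i ∸ 1) (take (j ∸ 1) S)

suffixFrom : {A : Set} → List A → ℕ → List A
suffixFrom S i = drop (i ∸ 1) S

module _ {A : Set} (_≟_ : DecidableEquality A) where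

  occFrom : ℕ → A → List A → List ℕ
  occFrom k c [] = []
  occFrom k c (x ∷ xs) with x ≟ c
  ... | yes _ = k ∷ occFrom (suc k) c xs
  ... | no  _ = occFrom (suc k) c xs

  occ : A → List A → List ℕ
  occ c S = occFrom 1 c S

-- k-th element (1-based) of a list of naturals; default 0 out of range
-- (only ever used in range in the statement).
nth : List ℕ → ℕ → ℕ
nth [] k = 0
nth (x ∷ xs) 1 = x
nth (x ∷ xs) zero = x
nth (x ∷ xs) (suc (suc k)) = nth xs (suc k)

_⊑_ : {A : Set} → List A → List A → Set
C ⊑ T = C ⊆ T

CommonSubseq : {A : Set} → List A → List A → List A → Set
CommonSubseq S₁ S₂ C = (C ⊑ S₁) × (C ⊑ S₂)

MaximalCommonSubseq : {A : Set} → List A → List A → List A → Set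
MaximalCommonSubseq S₁ S₂ C =
  CommonSubseq S₁ S₂ C × (∀ C' → CommonSubseq S₁ S₂ C' → C ⊑ C' → C' ≡ C)

InnerExtendable : {A : Set} → List A → List A → Set
InnerExtendable {A} S W =
  (W ++ W) ⊑ S ×
  Σ A (λ y → Σ (List A) (λ W₁ → Σ (List A) (λ W₂ →
    W₁ ≢ [] × W₂ ≢ [] × W ≡ W₁ ++ W₂ ×
    ((W₁ ++ y ∷ W₂) ++ (W₁ ++ y ∷ W₂)) ⊑ S)))

-- Suppose V = W₁ y W₂ extends Z = W₁ W₂ with V V a subsequence of S. A maximal common
-- subsequence across a cut at an occurrence of σ starts with σ, hence so does V, and the
-- first copy of V may be embedded starting at the first σ of S. The square V V then cuts S
-- at some i_{m+1} with V a common subsequence of S[i₁, i_{m+1}) and S[i_{m+1}, n]. Both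
-- halves contain the ≥ e copies of σ in V, so e ≤ m ≤ ℓ - e: the cut is at i_{e+1}, where V
-- would properly extend the maximal Y, or (ℓ odd) at i_{e+2}, where Y ⊑ V ⊑ S[i_{e+2}, n],
-- so that Y was replaced by a maximal Y' which V would properly extend.

module Submission where

open import Defs
open import Data.Nat using (ℕ; zero; suc; _≤_; _<_; _/_; _%_; _+_; _*_; _∸_; z≤n; s≤s; s≤s⁻¹; >-nonZero)
open import Data.Nat.Properties
  using (≤-trans; ≤-antisym; +-comm; +-suc; +-monoʳ-≤; +-cancelʳ-≤; m+n∸n≡m; 1+n≢n; n≮n; m≤n⇒m<n∨m≡n; m<m*n)
open import Data.Nat.DivMod using (m≡m%n+[m/n]*n; m%n<n; m/n<m; m≥n⇒m/n>0)
open import Data.Nat.Tactic.RingSolver using (solve-∀)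
open import Data.List using (List; []; _∷_; _++_; take; drop; length; replicate; filter)
open import Data.List.Properties
  using (++-assoc; length-++; length-++-sucʳ; length-replicate; filter-++; filter-accept; filter-reject; filter-all)
open import Data.List.Relation.Unary.All.Properties using (replicate⁺)
open import Data.List.Membership.Propositional using (_∈_)
open import Data.List.Relation.Binary.Sublist.Propositional using (_⊆_; []; _∷ʳ_; _∷_; ⊆-refl; ⊆-trans)
open import Data.List.Relation.Binary.Sublist.Propositional.Properties using (++⁺; ∷ˡ⁻; length-mono-≤; filter⁺)
open import Data.Product using (_×_; ∃-syntax; _,_; proj₂)
open import Data.Sum using (_⊎_; inj₁; inj₂)
open import Function using (id)
open import Relation.Nullary using (¬_; yes; no; contradiction)
open import Relation.Binary.Definitions using (DecidableEquality)
open import Relation.Binary.PropositionalEquality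
  using (_≡_; _≢_; refl; sym; trans; cong; cong₂; subst; subst₂; module ≡-Reasoning)

private variable
  A : Set
  x : A
  F G V X₁ X₂ Z Z' : List A

take-length-++ : ∀ (X R : List A) → take (length X) (X ++ R) ≡ X
take-length-++ []      R = refl
take-length-++ (x ∷ X) R = cong (x ∷_) (take-length-++ X R)

drop-length-++ : ∀ (X R : List A) → drop (length X) (X ++ R) ≡ R
drop-length-++ []      R = refl
drop-length-++ (x ∷ X) R = drop-length-++ X R

suffixFrom-++ : ∀ (X R : List A) → suffixFrom (X ++ R) (length X + 1) ≡ R
suffixFrom-++ X R = trans (cong (λ n → drop n (X ++ R)) (m+n∸n≡m (length X) 1)) (drop-length-++ X R)

factorCO-++ : ∀ (X Y R : List A) → factorCO ((X ++ Y) ++ R) (length X + 1) (length (X ++ Y) + 1) ≡ Y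
factorCO-++ X Y R = begin
  drop (length X + 1 ∸ 1) (take (length (X ++ Y) + 1 ∸ 1) ((X ++ Y) ++ R))
    ≡⟨ cong₂ (λ i j → drop i (take j ((X ++ Y) ++ R))) (m+n∸n≡m (length X) 1) (m+n∸n≡m (length (X ++ Y)) 1) ⟩
  drop (length X) (take (length (X ++ Y)) ((X ++ Y) ++ R))
    ≡⟨ cong (drop (length X)) (take-length-++ (X ++ Y) R) ⟩
  drop (length X) (X ++ Y)
    ≡⟨ drop-length-++ X Y ⟩
  Y ∎
  where open ≡-Reasoning

insert-⊆ : ∀ (W₁ : List A) y W₂ → W₁ ++ W₂ ⊆ W₁ ++ y ∷ W₂
insert-⊆ W₁ y W₂ = ++⁺ ⊆-refl (y ∷ʳ ⊆-refl)

insert-⊈ : ∀ (W₁ : List A) y W₂ → ¬ (W₁ ++ y ∷ W₂ ⊆ W₁ ++ W₂)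
insert-⊈ W₁ y W₂ p = n≮n _ (subst (_≤ length (W₁ ++ W₂)) (length-++-sucʳ W₁ y W₂) (length-mono-≤ p))

⊆-split : ∀ (X : List A) {x Y T} → X ++ x ∷ Y ⊆ T → ∃[ M ] ∃[ Q ] T ≡ M ++ x ∷ Q × X ⊆ M × Y ⊆ Q
⊆-split [] (refl ∷ p) = [] , _ , refl , [] , p
⊆-split X (t ∷ʳ p) =
  let M , Q , T≡ , X⊆M , Y⊆Q = ⊆-split X p in t ∷ M , Q , cong (t ∷_) T≡ , t ∷ʳ X⊆M , Y⊆Q
⊆-split (a ∷ X) (refl ∷ p) =
  let M , Q , T≡ , X⊆M , Y⊆Q = ⊆-split X p in a ∷ M , Q , cong (a ∷_) T≡ , refl ∷ X⊆M , Y⊆Q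

maximal-head : MaximalCommonSubseq (x ∷ F) (x ∷ G) Z → ∃[ Z' ] Z ≡ x ∷ Z'
maximal-head ((refl ∷ _ , _) , _) = _ , refl
maximal-head ((_ ∷ʳ _ , refl ∷ _) , _) = _ , refl
maximal-head {x = x} {Z = Z} ((_ ∷ʳ Z⊆F , _ ∷ʳ Z⊆G) , maximal) =
  contradiction (cong length (maximal (x ∷ Z) (refl ∷ Z⊆F , refl ∷ Z⊆G) (x ∷ʳ ⊆-refl))) 1+n≢n

maximal⇒¬common : MaximalCommonSubseq X₁ X₂ Z → Z ⊆ Z' → Z' ⊆ V → ¬ V ⊆ Z' → ¬ CommonSubseq X₁ X₂ V
maximal⇒¬common (_ , maximal) Z⊆Z' Z'⊆V V⊈Z' common =
  V⊈Z' (subst (_⊆ _) (sym (maximal _ common (⊆-trans Z⊆Z' Z'⊆V))) Z⊆Z')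

half-< : ∀ ℓ → 2 ≤ ℓ → ℓ / 2 < ℓ
half-< ℓ@(suc _) _ = m/n<m ℓ 2 (s≤s (s≤s z≤n))

odd⇒suc-half-< : ∀ ℓ → 2 ≤ ℓ → ℓ % 2 ≡ 1 → suc (ℓ / 2) < ℓ
odd⇒suc-half-< ℓ 2≤ℓ odd = subst (suc (ℓ / 2) <_) (sym ℓ≡1+e*2) (s≤s e<e*2)
  where
  ℓ≡1+e*2 : ℓ ≡ 1 + ℓ / 2 * 2
  ℓ≡1+e*2 = trans (m≡m%n+[m/n]*n ℓ 2) (cong (_+ ℓ / 2 * 2) odd)
  e<e*2 : ℓ / 2 < ℓ / 2 * 2
  e<e*2 = m<m*n (ℓ / 2) 2 {{>-nonZero (m≥n⇒m/n>0 2≤ℓ)}} (s≤s (s≤s z≤n))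

half-cases : ∀ ℓ {m} → ℓ / 2 ≤ m → m + ℓ / 2 ≤ ℓ → m ≡ ℓ / 2 ⊎ (ℓ % 2 ≡ 1 × m ≡ suc (ℓ / 2))
half-cases ℓ {m} e≤m m+e≤ℓ = by-remainder (m%n<n ℓ 2) (+-cancelʳ-≤ (ℓ / 2) m _ m+e≤r+e+e)
  where
  r+e*2≡r+e+e : ∀ r e → r + e * 2 ≡ r + e + e
  r+e*2≡r+e+e = solve-∀
  m+e≤r+e+e : m + ℓ / 2 ≤ ℓ % 2 + ℓ / 2 + ℓ / 2
  m+e≤r+e+e = subst (m + ℓ / 2 ≤_) (trans (m≡m%n+[m/n]*n ℓ 2) (r+e*2≡r+e+e (ℓ % 2) (ℓ / 2))) m+e≤ℓ
  by-remainder : ∀ {r} → r < 2 → m ≤ r + ℓ / 2 → m ≡ ℓ / 2 ⊎ (r ≡ 1 × m ≡ suc (ℓ / 2))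
  by-remainder {0} _ m≤e = inj₁ (≤-antisym m≤e e≤m)
  by-remainder {1} _ m≤1+e with m≤n⇒m<n∨m≡n m≤1+e
  ... | inj₁ m<1+e = inj₁ (≤-antisym (s≤s⁻¹ m<1+e) e≤m)
  ... | inj₂ m≡1+e = inj₂ (refl , m≡1+e)
  by-remainder {suc (suc _)} (s≤s (s≤s ())) _

module Occurrences {A : Set} (_≟_ : DecidableEquality A) (σ : A) where

  count : List A → ℕ
  count X = length (filter (_≟ σ) X)

  position : List A → ℕ → ℕ
  position S k = nth (occ _≟_ σ S) k

  cutˡ cutʳ : List A → ℕ → List A
  cutˡ S k = factorCO S (position S 1) (position S k)
  cutʳ S k = suffixFrom S (position S k)

  CommonAtCut MaximalAtCut : List A → ℕ → List A → Set
  CommonAtCut S k = CommonSubseq (cutˡ S k) (cutʳ S k)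
  MaximalAtCut S k = MaximalCommonSubseq (cutˡ S k) (cutʳ S k)

  count-σ∷ : ∀ X → count (σ ∷ X) ≡ suc (count X)
  count-σ∷ X = cong length (filter-accept (_≟ σ) refl)

  count-≢∷ : ∀ {x} → x ≢ σ → ∀ X → count (x ∷ X) ≡ count X
  count-≢∷ x≢σ X = cong length (filter-reject (_≟ σ) x≢σ)

  count-++ : ∀ X Y → count (X ++ Y) ≡ count X + count Y
  count-++ X Y = trans (cong length (filter-++ (_≟ σ) X Y)) (length-++ (filter (_≟ σ) X))

  count-σ-free-++ : ∀ P T → count P ≡ 0 → count (P ++ T) ≡ count T
  count-σ-free-++ P T P-σ-free = trans (count-++ P T) (cong (_+ count T) P-σ-free)

  count-mono : ∀ {X Y} → X ⊆ Y → count X ≤ count Y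
  count-mono X⊆Y = length-mono-≤ (filter⁺ (_≟ σ) (_≟ σ) (λ { refl → id }) X⊆Y)

  count-replicate : ∀ n → count (replicate n σ) ≡ n
  count-replicate n = trans (cong length (filter-all (_≟ σ) (replicate⁺ n refl))) (length-replicate n)

  length-occFrom : ∀ j X → length (occFrom _≟_ j σ X) ≡ count X
  length-occFrom j [] = refl
  length-occFrom j (x ∷ X) with x ≟ σ
  ... | yes _ = cong suc (length-occFrom (suc j) X)
  ... | no  _ = length-occFrom (suc j) X

  nth-occFrom : ∀ j X R → nth (occFrom _≟_ j σ (X ++ σ ∷ R)) (suc (count X)) ≡ length X + j
  nth-occFrom j [] R with σ ≟ σ
  ... | yes _   = refl
  ... | no σ≢σ = contradiction refl σ≢σ
  nth-occFrom j (x ∷ X) R with x ≟ σ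
  ... | yes _ = trans (nth-occFrom (suc j) X R) (+-suc (length X) j)
  ... | no  _ = trans (nth-occFrom (suc j) X R) (+-suc (length X) j)

  position-++-σ∷ : ∀ X R → position (X ++ σ ∷ R) (count X + 1) ≡ length X + 1
  position-++-σ∷ X R = subst (λ k → position (X ++ σ ∷ R) k ≡ length X + 1) (+-comm 1 (count X)) (nth-occFrom 1 X R)

  cuts-of-decomposition : ∀ P M Q → count P ≡ 0 →
    cutˡ (P ++ σ ∷ M ++ σ ∷ Q) (count (σ ∷ M) + 1) ≡ σ ∷ M × cutʳ (P ++ σ ∷ M ++ σ ∷ Q) (count (σ ∷ M) + 1) ≡ σ ∷ Q
  cuts-of-decomposition P M Q P-σ-free = cutˡ-shape , cutʳ-shape
    where
    open ≡-Reasoning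
    S L : List A
    S = P ++ σ ∷ M ++ σ ∷ Q
    L = P ++ σ ∷ M
    S≡ : S ≡ L ++ σ ∷ Q
    S≡ = sym (++-assoc P (σ ∷ M) (σ ∷ Q))
    first-σ : position S 1 ≡ length P + 1
    first-σ = subst (λ c → position S (c + 1) ≡ length P + 1) P-σ-free (position-++-σ∷ P (M ++ σ ∷ Q))
    cut-σ : position S (count (σ ∷ M) + 1) ≡ length L + 1
    cut-σ = subst₂ (λ T c → position T (c + 1) ≡ length L + 1) (sym S≡) (count-σ-free-++ P (σ ∷ M) P-σ-free)
            (position-++-σ∷ L Q)
    cutˡ-shape : cutˡ S (count (σ ∷ M) + 1) ≡ σ ∷ M
    cutˡ-shape = begin
      factorCO S (position S 1) (position S (count (σ ∷ M) + 1))
        ≡⟨ cong₂ (factorCO S) first-σ cut-σ ⟩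
      factorCO S (length P + 1) (length L + 1)
        ≡⟨ cong (λ T → factorCO T (length P + 1) (length L + 1)) S≡ ⟩
      factorCO (L ++ σ ∷ Q) (length P + 1) (length L + 1)
        ≡⟨ factorCO-++ P (σ ∷ M) (σ ∷ Q) ⟩
      σ ∷ M ∎
    cutʳ-shape : cutʳ S (count (σ ∷ M) + 1) ≡ σ ∷ Q
    cutʳ-shape = begin
      suffixFrom S (position S (count (σ ∷ M) + 1))
        ≡⟨ cong (suffixFrom S) cut-σ ⟩
      suffixFrom S (length L + 1)
        ≡⟨ cong (λ T → suffixFrom T (length L + 1)) S≡ ⟩
      suffixFrom (L ++ σ ∷ Q) (length L + 1)
        ≡⟨ suffixFrom-++ L (σ ∷ Q) ⟩
      σ ∷ Q ∎

  split-at-count : ∀ t S → t < count S → ∃[ L ] ∃[ R ] S ≡ L ++ σ ∷ R × count L ≡ t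
  split-at-count t (x ∷ S) t<count with x ≟ σ
  split-at-count zero    (x ∷ S) _             | yes refl = [] , S , refl , refl
  split-at-count (suc t) (x ∷ S) (s≤s t<count) | yes refl =
    let L , R , S≡ , count-L = split-at-count t S t<count
    in σ ∷ L , R , cong (σ ∷_) S≡ , trans (count-σ∷ L) (cong suc count-L)
  split-at-count t       (x ∷ S) t<count       | no x≢σ =
    let L , R , S≡ , count-L = split-at-count t S t<count
    in x ∷ L , R , cong (x ∷_) S≡ , trans (count-≢∷ x≢σ L) count-L

  decompose-at-cut : ∀ m S → 0 < m → m < count S →
    ∃[ P ] ∃[ M ] ∃[ Q ] S ≡ P ++ σ ∷ M ++ σ ∷ Q × count P ≡ 0 × count (σ ∷ M) ≡ m
  decompose-at-cut m S 0<m m<count with split-at-count m S m<count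
  ... | L , Q , refl , refl with split-at-count 0 L 0<m
  ... | P , M , refl , P-σ-free =
    P , M , Q , ++-assoc P (σ ∷ M) (σ ∷ Q) , P-σ-free , sym (count-σ-free-++ P (σ ∷ M) P-σ-free)

  maximal-at-cut-head : ∀ m S {Z} → 0 < m → m < count S → MaximalAtCut S (m + 1) Z → ∃[ Z' ] Z ≡ σ ∷ Z'
  maximal-at-cut-head m S 0<m m<count maximal with decompose-at-cut m S 0<m m<count
  ... | P , M , Q , refl , P-σ-free , refl =
    let cutˡ≡ , cutʳ≡ = cuts-of-decomposition P M Q P-σ-free
    in maximal-head (subst₂ (λ F G → MaximalCommonSubseq F G _) cutˡ≡ cutʳ≡ maximal)

  first-occurrence : ∀ {W T} → σ ∷ W ⊆ T → ∃[ P ] ∃[ R ] T ≡ P ++ σ ∷ R × count P ≡ 0 × W ⊆ R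
  first-occurrence (refl ∷ W⊆R) = [] , _ , refl , refl , W⊆R
  first-occurrence (t ∷ʳ σW⊆T) with t ≟ σ
  ... | yes refl = [] , _ , refl , refl , ∷ˡ⁻ σW⊆T
  ... | no t≢σ =
    let P , R , T≡ , P-σ-free , W⊆R = first-occurrence σW⊆T
    in t ∷ P , R , cong (t ∷_) T≡ , trans (count-≢∷ t≢σ P) P-σ-free , W⊆R

  square-decomposition : ∀ {V S} → (σ ∷ V) ++ (σ ∷ V) ⊆ S →
    ∃[ P ] ∃[ M ] ∃[ Q ] S ≡ P ++ σ ∷ M ++ σ ∷ Q × count P ≡ 0 × V ⊆ M × V ⊆ Q
  square-decomposition {V} VV⊆S =
    let P , T , S≡ , P-σ-free , VσV⊆T = first-occurrence VV⊆S
        M , Q , T≡ , V⊆M , V⊆Q = ⊆-split V VσV⊆T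
    in P , M , Q , trans S≡ (cong (λ T → P ++ σ ∷ T) T≡) , P-σ-free , V⊆M , V⊆Q

  square-common-at-cut : ∀ {V S} → (σ ∷ V) ++ (σ ∷ V) ⊆ S →
    ∃[ m ] CommonAtCut S (m + 1) (σ ∷ V) × count (σ ∷ V) ≤ m × m + count (σ ∷ V) ≤ count S
  square-common-at-cut {V} VV⊆S with square-decomposition VV⊆S
  ... | P , M , Q , refl , P-σ-free , V⊆M , V⊆Q =
    let cutˡ≡ , cutʳ≡ = cuts-of-decomposition P M Q P-σ-free
    in count (σ ∷ M)
     , (subst (σ ∷ V ⊆_) (sym cutˡ≡) (refl ∷ V⊆M) , subst (σ ∷ V ⊆_) (sym cutʳ≡) (refl ∷ V⊆Q))
     , count-mono (refl ∷ V⊆M)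
     , subst (count (σ ∷ M) + count (σ ∷ V) ≤_) count-S (+-monoʳ-≤ (count (σ ∷ M)) (count-mono (refl ∷ V⊆Q)))
    where
    count-S : count (σ ∷ M) + count (σ ∷ Q) ≡ count (P ++ σ ∷ M ++ σ ∷ Q)
    count-S = sym (trans (count-σ-free-++ P _ P-σ-free) (count-++ (σ ∷ M) (σ ∷ Q)))

  inner-extension-common-at-cut : ∀ {S Z} → ∃[ Z' ] Z ≡ σ ∷ Z' → InnerExtendable S Z →
    ∃[ V ] ∃[ m ] Z ⊆ V × ¬ V ⊆ Z × CommonAtCut S (m + 1) V × count V ≤ m × m + count V ≤ count S
  inner-extension-common-at-cut (_ , refl) (_ , _ , [] , _ , W₁≢[] , _) = contradiction refl W₁≢[]
  inner-extension-common-at-cut (_ , refl) (_ , y , _ ∷ W₁ , W₂ , _ , _ , refl , VV⊆S) =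
    let m , common , V≤m , bound = square-common-at-cut VV⊆S
    in σ ∷ W₁ ++ y ∷ W₂ , m , insert-⊆ (σ ∷ W₁) y W₂ , insert-⊈ (σ ∷ W₁) y W₂ , common , V≤m , bound

  cut-near-half : ∀ {S V m} → let ℓ = length (occ _≟_ σ S); e = ℓ / 2 in
    replicate e σ ⊆ V → count V ≤ m → m + count V ≤ count S → m ≡ e ⊎ (ℓ % 2 ≡ 1 × m ≡ suc e)
  cut-near-half {S} {V} {m} σᵉ⊆V V≤m bound = half-cases ℓ (≤-trans e≤V V≤m) m+e≤ℓ
    where
    ℓ e : ℕ
    ℓ = length (occ _≟_ σ S)
    e = ℓ / 2
    e≤V : e ≤ count V
    e≤V = subst (_≤ count V) (count-replicate e) (count-mono σᵉ⊆V)
    m+e≤ℓ : m + e ≤ ℓ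
    m+e≤ℓ = subst (m + e ≤_) (sym (length-occFrom 1 S)) (≤-trans (+-monoʳ-≤ m e≤V) bound)

  inner-extension-common-near-half : ∀ {S Z} → let ℓ = length (occ _≟_ σ S); e = ℓ / 2 in
    ∃[ Z' ] Z ≡ σ ∷ Z' → replicate e σ ⊆ Z → InnerExtendable S Z →
    ∃[ V ] Z ⊆ V × ¬ V ⊆ Z × (CommonAtCut S (e + 1) V ⊎ (ℓ % 2 ≡ 1 × CommonAtCut S (e + 2) V))
  inner-extension-common-near-half {S} Z-head σᵉ⊆Z inner with inner-extension-common-at-cut Z-head inner
  ... | V , m , Z⊆V , V⊈Z , common , V≤m , bound with cut-near-half {S} (⊆-trans σᵉ⊆Z Z⊆V) V≤m bound
  ... | inj₁ refl         = V , Z⊆V , V⊈Z , inj₁ common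
  ... | inj₂ (odd , refl) = V , Z⊆V , V⊈Z , inj₂ (odd , subst (λ k → CommonAtCut S k V) (sym (+-suc _ 1)) common)

lemma4 : {A : Set} (_≟_ : DecidableEquality A) (S : List A) →
    (∀ c → c ∈ S → 2 ≤ length (occ _≟_ c S)) →
    (σ : A) → 2 ≤ length (occ _≟_ σ S) →
    let ℓ = length (occ _≟_ σ S)
        i = λ k → nth (occ _≟_ σ S) k
        e = ℓ / 2
    in (Y : List A) →
       MaximalCommonSubseq (factorCO S (i 1) (i (e + 1))) (suffixFrom S (i (e + 1))) Y →
       replicate e σ ⊑ Y →
       (¬ (ℓ % 2 ≡ 1 × Y ⊑ suffixFrom S (i (e + 2))) → ¬ InnerExtendable S Y)
       × (ℓ % 2 ≡ 1 → Y ⊑ suffixFrom S (i (e + 2)) →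
          (Y' : List A) →
          MaximalCommonSubseq (factorCO S (i 1) (i (e + 2))) (suffixFrom S (i (e + 2))) Y' →
          Y ⊑ Y' → ¬ InnerExtendable S Y')
lemma4 {A} _≟_ S _ σ 2≤ℓ Y maxY σᵉ⊆Y = Y-not-inner , Y'-not-inner
  where
  open Occurrences _≟_ σ
  ℓ e : ℕ
  ℓ = length (occ _≟_ σ S)
  e = ℓ / 2

  ℓ≡count : ℓ ≡ count S
  ℓ≡count = length-occFrom 1 S

  Y-head : ∃[ Y₀ ] Y ≡ σ ∷ Y₀
  Y-head = maximal-at-cut-head e S (m≥n⇒m/n>0 2≤ℓ) (subst (e <_) ℓ≡count (half-< ℓ 2≤ℓ)) maxY

  Y-not-inner : ¬ (ℓ % 2 ≡ 1 × Y ⊆ cutʳ S (e + 2)) → ¬ InnerExtendable S Y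
  Y-not-inner Y⊈cutʳ inner with inner-extension-common-near-half Y-head σᵉ⊆Y inner
  ... | V , Y⊆V , V⊈Y , inj₁ common         = maximal⇒¬common maxY ⊆-refl Y⊆V V⊈Y common
  ... | V , Y⊆V , V⊈Y , inj₂ (odd , common) = Y⊈cutʳ (odd , ⊆-trans Y⊆V (proj₂ common))

  Y'-head : ℓ % 2 ≡ 1 → ∀ {Y'} → MaximalAtCut S (e + 2) Y' → ∃[ Y₀ ] Y' ≡ σ ∷ Y₀
  Y'-head odd {Y'} maxY' =
    maximal-at-cut-head (suc e) S (s≤s z≤n) (subst (suc e <_) ℓ≡count (odd⇒suc-half-< ℓ 2≤ℓ odd))
      (subst (λ k → MaximalAtCut S k Y') (+-suc e 1) maxY')

  Y'-not-inner : ℓ % 2 ≡ 1 → Y ⊆ cutʳ S (e + 2) →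
    (Y' : List A) → MaximalAtCut S (e + 2) Y' → Y ⊆ Y' → ¬ InnerExtendable S Y'
  Y'-not-inner odd _ Y' maxY' Y⊆Y' inner
    with inner-extension-common-near-half (Y'-head odd maxY') (⊆-trans σᵉ⊆Y Y⊆Y') inner
  ... | V , Y'⊆V , V⊈Y' , inj₁ common       = maximal⇒¬common maxY Y⊆Y' Y'⊆V V⊈Y' common
  ... | V , Y'⊆V , V⊈Y' , inj₂ (_ , common) = maximal⇒¬common maxY' ⊆-refl Y'⊆V V⊈Y' common
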